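{- Let $k\ge 3$. Every $\{0,1\}$-constructable $k$-hypergraph is $T2$-threshold, and it is also $T3$-threshold. In particular, every antiregular $k$-hypergraph is $T2$-threshold and $T3$-threshold.
   Context: A $k$-hypergraph is a hypergraph all of whose hyperedges have exactly $k$ vertices. A $k$-hypergraph is $\{0,1\}$-constructable if it can be built, starting from the empty hypergraph, by repeatedly adding either an isolated vertex (no new hyperedges) or a dominating vertex $v$ (adding as hyperedges all sets $\{v\}\cup S$ with $S$ a $(k-1)$-subset of the vertices already present), in some order. Antiregular $k$-hypergraphs are those built by first adding $k-1$ isolated vertices and then alternately adding isolated and dominating vertices (starting with either kind). A $k$-hypergraph $H=(V,E)$ is $T2$-threshold if there exist a labeling $c:V\to\mathbb{R}$ and a threshold $\tau$ such that for every $k$-element subset $X\subseteq V$, $X\in E$ iff $\sum_{x\in X}c(x)>\tau$. For $x,y\in V$ write $x\ll y$ if for every $(k-1)$-element subset $S\subseteq V\setminus\{x,y\}$, $S\cup\{x\}\in E$ implies $S\cup\{y\}\in E$; $H$ is $T3$-threshold if for all $x,y\in V$, $x\ll y$ or $y\ll x$ (or both). -}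

module Defs where

open import Data.Nat using (ℕ; zero; suc; _∸_; _<?_)
open import Data.Bool using (Bool; true; false; not; if_then_else_)
open import Data.Fin using (Fin; toℕ; zero; suc) renaming (_≤_ to _≤ᶠ_)
open import Data.Fin.Subset using (Subset; _∈_; _∉_; ∣_∣; ⁅_⁆; _∪_)
open import Data.Fin.Permutation using (Permutation′; _⟨$⟩ʳ_)
open import Data.Vec using ([]; _∷_)
open import Data.Rational using (ℚ; 0ℚ; _+_; _<_)
open import Data.Product using (Σ; ∃; ∃-syntax; _×_)
open import Data.Sum using (_⊎_)
open import Relation.Binary.PropositionalEquality using (_≡_)
open import Relation.Nullary using (does)
open import Function.Bundles using (_⇔_)

record Hypergraph (k : ℕ) : Set₁ where
  field
    n        : ℕ
    E        : Subset n → Set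
    uniform  : ∀ X → E X → ∣ X ∣ ≡ k
open Hypergraph public

-- Vertex kinds in a construction sequence: true = dominating, false = isolated.
-- A construction of H: a bijection pos : V → {0,…,n-1} giving the step at
-- which each vertex is added, and the kind of each vertex.  Adding vertex v
-- as dominating adds exactly the k-sets containing v whose other vertices
-- were added before v; adding it as isolated adds nothing.  Hence the
-- resulting edge set consists exactly of the k-sets X whose last-added
-- vertex is dominating.
IsConstructedBy : {k : ℕ} (H : Hypergraph k) →
                  Permutation′ (n H) → (Fin (n H) → Bool) → Set
IsConstructedBy {k} H pos kind =
  ∀ (X : Subset (n H)) → ∣ X ∣ ≡ k →
    (E H X ⇔ (∃[ v ] (v ∈ X × kind v ≡ true ×
                      (∀ u → u ∈ X → (pos ⟨$⟩ʳ u) ≤ᶠ (pos ⟨$⟩ʳ v)))))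

Constructable01 : {k : ℕ} → Hypergraph k → Set
Constructable01 H = ∃[ pos ] ∃[ kind ] IsConstructedBy H pos kind

alt : Bool → ℕ → Bool
alt b zero    = b
alt b (suc d) = alt (not b) d

-- kind of the vertex added at step p (0-based) in an antiregular construction:
-- first k-1 isolated vertices, then alternately, starting with kind b.
antiKind : ℕ → Bool → ℕ → Bool
antiKind k b p = if does (p <? (k ∸ 1)) then false else alt b (p ∸ (k ∸ 1))

Antiregular : {k : ℕ} → Hypergraph k → Set
Antiregular {k} H =
  ∃[ pos ] ∃[ b ] IsConstructedBy H pos (λ v → antiKind k b (toℕ (pos ⟨$⟩ʳ v)))

subsetSum : {m : ℕ} → (Fin m → ℚ) → Subset m → ℚ
subsetSum {zero}  c []            = 0ℚ
subsetSum {suc m} c (true  ∷ X)   = c zero + subsetSum (λ i → c (suc i)) X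
subsetSum {suc m} c (false ∷ X)   = subsetSum (λ i → c (suc i)) X

T2Threshold : {k : ℕ} → Hypergraph k → Set
T2Threshold {k} H =
  ∃[ c ] ∃[ τ ] (∀ (X : Subset (n H)) → ∣ X ∣ ≡ k → (E H X ⇔ τ < subsetSum c X))

Below : {k : ℕ} (H : Hypergraph k) → Fin (n H) → Fin (n H) → Set
Below {k} H x y =
  ∀ (S : Subset (n H)) → ∣ S ∣ ≡ k ∸ 1 → x ∉ S → y ∉ S →
    E H (S ∪ ⁅ x ⁆) → E H (S ∪ ⁅ y ⁆)

T3Threshold : {k : ℕ} → Hypergraph k → Set
T3Threshold H = ∀ x y → Below H x y ⊎ Below H y x

{-# OPTIONS --safe #-}
-- Label the vertex added at step p by ±(1+n)^(p+1), positive iff it is dominating.  The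
-- label of the last-added vertex of a k-set exceeds n times any earlier label in absolute
-- value, so the label sum has its sign: it is positive exactly when that vertex is
-- dominating, i.e. exactly on edges.
-- For T3, let x be added before y.  Exchanging x for y in S ∪ {x} keeps the last vertex
-- dominating when y is dominating, and exchanging y for x keeps it when y is isolated
-- (an isolated y is never the dominating last vertex); hence x ≪ y or y ≪ x respectively.
module Submission where

open import Defs
open import Data.Nat using (ℕ; zero; suc; _≤_; _<_; _≤′_; ≤′-refl; ≤′-step; _∸_; s≤s; z≤n)
import Data.Nat.Properties as ℕ
open import Data.Bool using (Bool; true; false)
open import Data.Product using (_×_; _,_; proj₁; proj₂; ∃-syntax)
open import Data.Sum using (_⊎_; inj₁; inj₂; [_,_]′; swap)
open import Data.Fin using (Fin; zero; suc; toℕ)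
open import Data.Fin.Properties using (toℕ-injective; suc-injective)
open import Data.Fin.Subset using (Subset; _∈_; _∉_; ∣_∣; ⁅_⁆; _∪_; ⊥; inside; outside; Nonempty)
open import Data.Fin.Subset.Properties
  using (x∈p∪q⁻; x∈p∪q⁺; x∈⁅x⁆; x∈⁅y⁆⇒x≡y; ∪-identityʳ; nonempty?; Empty-unique)
open import Data.Fin.Permutation using (Permutation′; _⟨$⟩ʳ_)
open import Data.Vec using (_∷_; []; here; there)
open import Data.Rational using (ℚ; 0ℚ; 1ℚ; _+_; -_) renaming (_≤_ to _≤ℚ_; _<_ to _<ℚ_)
import Data.Rational.Properties as ℚ
open import Algebra.Bundles using (CommutativeMonoid)
open import Algebra.Properties.CommutativeMonoid.Mult ℚ.+-0-commutativeMonoid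
  using (×-distrib-+) renaming (_×_ to _·_)
open import Algebra.Properties.CommutativeSemigroup
  (CommutativeMonoid.commutativeSemigroup ℚ.+-0-commutativeMonoid) using (x∙yz≈y∙xz)
open import Algebra.Properties.Group ℚ.+-0-group using () renaming (⁻¹-involutive to neg-involutive)
open import Function using (_∘_; id)
open import Function.Bundles using (_⇔_; Injection; mk⇔; Equivalence)
open import Function.Properties.Inverse using (↔⇒↣)
open import Relation.Binary.Definitions using (tri<; tri≈; tri>)
open import Relation.Binary.PropositionalEquality using (_≡_; _≢_; refl; sym; trans; cong; subst; module ≡-Reasoning)
open import Relation.Nullary using (yes; no; contradiction)

nonPos+q≤q : ∀ {a} q → a ≤ℚ 0ℚ → a + q ≤ℚ q
nonPos+q≤q q a≤0 = ℚ.≤-trans (ℚ.+-monoˡ-≤ q a≤0) (ℚ.≤-reflexive (ℚ.+-identityˡ q))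

·-zeroʳ : ∀ m → m · 0ℚ ≡ 0ℚ
·-zeroʳ zero    = refl
·-zeroʳ (suc m) = trans (ℚ.+-identityˡ (m · 0ℚ)) (·-zeroʳ m)

subsetSum-⊥ : ∀ {m} (c : Fin m → ℚ) → subsetSum c ⊥ ≡ 0ℚ
subsetSum-⊥ {zero}  c = refl
subsetSum-⊥ {suc m} c = subsetSum-⊥ (c ∘ suc)

subsetSum-neg : ∀ {m} (c : Fin m → ℚ) X → subsetSum (-_ ∘ c) X ≡ - subsetSum c X
subsetSum-neg c []            = refl
subsetSum-neg c (outside ∷ X) = subsetSum-neg (c ∘ suc) X
subsetSum-neg c (inside ∷ X)  =
  trans (cong (- c zero +_) (subsetSum-neg (c ∘ suc) X))
        (sym (ℚ.neg-distrib-+ (c zero) (subsetSum (c ∘ suc) X)))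

subsetSum-lowerBound : ∀ {m} (c : Fin m → ℚ) X {a} → a ≤ℚ 0ℚ →
                       (∀ u → u ∈ X → a ≤ℚ c u) → m · a ≤ℚ subsetSum c X
subsetSum-lowerBound c []            a≤0 a≤c = ℚ.≤-refl
subsetSum-lowerBound c (outside ∷ X) a≤0 a≤c =
  ℚ.≤-trans (nonPos+q≤q _ a≤0) (subsetSum-lowerBound (c ∘ suc) X a≤0 (λ u → a≤c (suc u) ∘ there))
subsetSum-lowerBound c (inside ∷ X)  a≤0 a≤c =
  ℚ.+-mono-≤ (a≤c zero here) (subsetSum-lowerBound (c ∘ suc) X a≤0 (λ u → a≤c (suc u) ∘ there))

subsetSum-lowerBound-except : ∀ {m} (c : Fin m → ℚ) X {v a} → v ∈ X → a ≤ℚ 0ℚ →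
                              (∀ u → u ∈ X → u ≢ v → a ≤ℚ c u) → c v + m · a ≤ℚ subsetSum c X
subsetSum-lowerBound-except c (inside ∷ X) here a≤0 a≤c =
  ℚ.+-monoʳ-≤ (c zero) (ℚ.≤-trans (nonPos+q≤q _ a≤0)
    (subsetSum-lowerBound (c ∘ suc) X a≤0 (λ u u∈X → a≤c (suc u) (there u∈X) λ ())))
subsetSum-lowerBound-except {suc m} c (s ∷ X) {suc v} {a} (there v∈X) a≤0 a≤c = with-head s a≤c
  where
  ih : c (suc v) + m · a ≤ℚ subsetSum (c ∘ suc) X
  ih = subsetSum-lowerBound-except (c ∘ suc) X v∈X a≤0
         (λ u u∈X u≢v → a≤c (suc u) (there u∈X) (u≢v ∘ suc-injective))
  with-head : ∀ s → (∀ u → u ∈ s ∷ X → u ≢ suc v → a ≤ℚ c u) →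
              c (suc v) + suc m · a ≤ℚ subsetSum c (s ∷ X)
  with-head outside _ = ℚ.≤-trans (ℚ.+-monoʳ-≤ (c (suc v)) (nonPos+q≤q _ a≤0)) ih
  with-head inside a≤c′ = begin
    c (suc v) + (a + m · a)  ≡⟨ x∙yz≈y∙xz (c (suc v)) a (m · a) ⟩
    a + (c (suc v) + m · a)  ≤⟨ ℚ.+-mono-≤ (a≤c′ zero here λ ()) ih ⟩
    c zero + subsetSum (c ∘ suc) X ∎
    where open ℚ.≤-Reasoning

·-nonNeg : ∀ m {q} → 0ℚ ≤ℚ q → 0ℚ ≤ℚ m · q
·-nonNeg zero    0≤q = ℚ.≤-refl
·-nonNeg (suc m) 0≤q = ℚ.+-mono-≤ 0≤q (·-nonNeg m 0≤q)

+·-cancelʳ : ∀ m B → (B + m · B) + m · (- B) ≡ B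
+·-cancelʳ m B = begin
  (B + m · B) + m · (- B)  ≡⟨ ℚ.+-assoc B (m · B) (m · (- B)) ⟩
  B + (m · B + m · (- B))  ≡⟨ cong (B +_) (×-distrib-+ B (- B) m) ⟨
  B + m · (B + - B)        ≡⟨ cong (λ x → B + m · x) (ℚ.+-inverseʳ B) ⟩
  B + m · 0ℚ               ≡⟨ cong (B +_) (·-zeroʳ m) ⟩
  B + 0ℚ                   ≡⟨ ℚ.+-identityʳ B ⟩
  B                        ∎
  where open ≡-Reasoning

dominant⇒subsetSum-pos : ∀ {m} (c : Fin m → ℚ) X {v B} → v ∈ X → 0ℚ <ℚ B →
                            c v ≡ B + m · B → (∀ u → u ∈ X → u ≢ v → - B ≤ℚ c u) →
                            0ℚ <ℚ subsetSum c X
dominant⇒subsetSum-pos {m} c X {v} {B} v∈X 0<B cv≡ -B≤c = begin-strict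
  0ℚ                   <⟨ 0<B ⟩
  B                    ≡⟨ +·-cancelʳ m B ⟨
  B + m · B + m · - B  ≡⟨ cong (λ x → x + m · - B) cv≡ ⟨
  c v + m · - B        ≤⟨ subsetSum-lowerBound-except c X v∈X (ℚ.neg-antimono-≤ (ℚ.<⇒≤ 0<B)) -B≤c ⟩
  subsetSum c X        ∎
  where open ℚ.≤-Reasoning

signed : Bool → ℚ → ℚ
signed true  q = q
signed false q = - q

-w≤w : ∀ {w} → 0ℚ ≤ℚ w → - w ≤ℚ w
-w≤w 0≤w = ℚ.≤-trans (ℚ.neg-antimono-≤ 0≤w) 0≤w

signed-bounded : ∀ b {w B} → 0ℚ ≤ℚ w → w ≤ℚ B → - B ≤ℚ signed b w × signed b w ≤ℚ B
signed-bounded true  0≤w w≤B = ℚ.≤-trans (ℚ.neg-antimono-≤ w≤B) (-w≤w 0≤w) , w≤B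
signed-bounded false 0≤w w≤B = ℚ.neg-antimono-≤ w≤B , ℚ.≤-trans (-w≤w 0≤w) w≤B

module RankLabelling {m} (rank : Fin m → ℕ) (kind : Fin m → Bool) where

  weight : ℕ → ℚ
  weight zero    = 1ℚ
  weight (suc p) = weight p + m · weight p

  weight-pos : ∀ p → 0ℚ <ℚ weight p
  weight-pos zero    = ℚ.positive⁻¹ 1ℚ
  weight-pos (suc p) = ℚ.+-mono-<-≤ (weight-pos p) (·-nonNeg m (ℚ.<⇒≤ (weight-pos p)))

  weight-mono : ∀ {p q} → p ≤ q → weight p ≤ℚ weight q
  weight-mono = mono′ ∘ ℕ.≤⇒≤′
    where
    mono′ : ∀ {p q} → p ≤′ q → weight p ≤ℚ weight q
    mono′ ≤′-refl          = ℚ.≤-refl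
    mono′ (≤′-step {q} p≤q) = ℚ.≤-trans (mono′ p≤q)
      (ℚ.≤-trans (ℚ.≤-reflexive (sym (ℚ.+-identityʳ (weight q))))
                 (ℚ.+-monoʳ-≤ (weight q) (·-nonNeg m (ℚ.<⇒≤ (weight-pos q)))))

  label : Fin m → ℚ
  label u = signed (kind u) (weight (suc (rank u)))

  module _ (X : Subset m) {v} (v∈X : v ∈ X) (rank< : ∀ u → u ∈ X → u ≢ v → rank u < rank v) where

    private
      B = weight (rank v)

      label-bounded : ∀ u → u ∈ X → u ≢ v → - B ≤ℚ label u × label u ≤ℚ B
      label-bounded u u∈X u≢v = signed-bounded (kind u) (ℚ.<⇒≤ (weight-pos (suc (rank u))))
                                               (weight-mono (rank< u u∈X u≢v))

    leader-dominating⇒subsetSum-pos : kind v ≡ true → 0ℚ <ℚ subsetSum label X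
    leader-dominating⇒subsetSum-pos kv = dominant⇒subsetSum-pos label X v∈X (weight-pos (rank v))
      (cong (λ b → signed b (weight (suc (rank v)))) kv)
      (λ u u∈X u≢v → proj₁ (label-bounded u u∈X u≢v))

    leader-isolated⇒subsetSum-neg : kind v ≡ false → subsetSum label X <ℚ 0ℚ
    leader-isolated⇒subsetSum-neg kv =
      subst (_<ℚ 0ℚ) (neg-involutive (subsetSum label X)) (ℚ.neg-antimono-< 0<-sum)
      where
      0<-sum : 0ℚ <ℚ - subsetSum label X
      0<-sum = subst (0ℚ <ℚ_) (subsetSum-neg label X)
        (dominant⇒subsetSum-pos (-_ ∘ label) X v∈X (weight-pos (rank v))
          (trans (cong (λ b → - signed b (weight (suc (rank v)))) kv) (neg-involutive _))
          (λ u u∈X u≢v → ℚ.neg-antimono-≤ (proj₂ (label-bounded u u∈X u≢v))))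

∃-maximal : ∀ {m} (f : Fin m → ℕ) {X : Subset m} → Nonempty X →
            ∃[ v ] (v ∈ X × ∀ u → u ∈ X → f u ≤ f v)
∃-maximal f {s ∷ X} (w , w∈) with nonempty? X
∃-maximal f {s ∷ X} (zero , here) | no ¬ne =
  zero , here , λ { zero here → ℕ.≤-refl ; (suc u) (there u∈X) → contradiction (u , u∈X) ¬ne }
∃-maximal f {s ∷ X} (suc w , there w∈X) | no ¬ne = contradiction (w , w∈X) ¬ne
∃-maximal f {s ∷ X} _ | yes ne with ∃-maximal (f ∘ suc) ne
∃-maximal f {outside ∷ X} _ | yes ne | v , v∈X , max =
  suc v , there v∈X , λ { (suc u) (there u∈X) → max u u∈X }
∃-maximal f {inside ∷ X} _ | yes ne | v , v∈X , max with f zero ℕ.≤? f (suc v)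
... | yes f0≤fv = suc v , there v∈X , λ { zero here → f0≤fv ; (suc u) (there u∈X) → max u u∈X }
... | no f0≰fv  = zero , here , λ { zero here → ℕ.≤-refl
                                  ; (suc u) (there u∈X) → ℕ.≤-trans (max u u∈X) (ℕ.≰⇒≥ f0≰fv) }

∣p∪⁅x⁆∣≡1+∣p∣ : ∀ {m} (p : Subset m) {x} → x ∉ p → ∣ p ∪ ⁅ x ⁆ ∣ ≡ suc ∣ p ∣
∣p∪⁅x⁆∣≡1+∣p∣ (outside ∷ p) {zero}  _   = cong (suc ∘ ∣_∣) (∪-identityʳ p)
∣p∪⁅x⁆∣≡1+∣p∣ (inside ∷ p)  {zero}  x∉p = contradiction here x∉p
∣p∪⁅x⁆∣≡1+∣p∣ (outside ∷ p) {suc x} x∉p = ∣p∪⁅x⁆∣≡1+∣p∣ p (x∉p ∘ there)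
∣p∪⁅x⁆∣≡1+∣p∣ (inside ∷ p)  {suc x} x∉p = cong suc (∣p∪⁅x⁆∣≡1+∣p∣ p (x∉p ∘ there))

∪⁅⁆-all : ∀ {m} {P : Fin m → Set} p {x} → (∀ u → u ∈ p → P u) → P x → ∀ u → u ∈ p ∪ ⁅ x ⁆ → P u
∪⁅⁆-all {P = P} p {x} all-p Px u u∈ = [ all-p u , (λ u∈⁅x⁆ → subst P (sym (x∈⁅y⁆⇒x≡y x u∈⁅x⁆)) Px) ]′
                                         (x∈p∪q⁻ p ⁅ x ⁆ u∈)

∪⁅⁆-∈-≢ : ∀ {m} (p : Subset m) {x u} → u ∈ p ∪ ⁅ x ⁆ → u ≢ x → u ∈ p
∪⁅⁆-∈-≢ p {x} u∈ u≢x = [ id , (λ u∈⁅x⁆ → contradiction (x∈⁅y⁆⇒x≡y x u∈⁅x⁆) u≢x) ]′ (x∈p∪q⁻ p ⁅ x ⁆ u∈)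

module Constructed {k} (H : Hypergraph k) (pos : Permutation′ (n H)) (kind : Fin (n H) → Bool)
                   (con : IsConstructedBy H pos kind) where

  rank : Fin (n H) → ℕ
  rank u = toℕ (pos ⟨$⟩ʳ u)

  rank-injective : ∀ {u v} → rank u ≡ rank v → u ≡ v
  rank-injective = Injection.injective (↔⇒↣ pos) ∘ toℕ-injective

  HasDominatingLast : Subset (n H) → Set
  HasDominatingLast X = ∃[ v ] (v ∈ X × kind v ≡ true × ∀ u → u ∈ X → rank u ≤ rank v)

  last-strict : ∀ {X v} → (∀ u → u ∈ X → rank u ≤ rank v) → ∀ u → u ∈ X → u ≢ v → rank u < rank v
  last-strict max u u∈X u≢v = ℕ.≤∧≢⇒< (max u u∈X) (u≢v ∘ rank-injective)

  open RankLabelling rank kind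

  isT2Threshold : T2Threshold H
  isT2Threshold = label , 0ℚ , λ X ∣X∣≡k → mk⇔ (edge⇒pos X ∣X∣≡k) (pos⇒edge X ∣X∣≡k)
    where
    edge⇒pos : ∀ X → ∣ X ∣ ≡ k → E H X → 0ℚ <ℚ subsetSum label X
    edge⇒pos X ∣X∣≡k e with Equivalence.to (con X ∣X∣≡k) e
    ... | v , v∈X , kv , max = leader-dominating⇒subsetSum-pos X v∈X (last-strict max) kv

    pos⇒edge : ∀ X → ∣ X ∣ ≡ k → 0ℚ <ℚ subsetSum label X → E H X
    pos⇒edge X ∣X∣≡k 0<S with nonempty? X
    ... | no ¬ne = contradiction 0<S (ℚ.<-irrefl (sym (trans (cong (subsetSum label) (Empty-unique ¬ne))
                                                           (subsetSum-⊥ label))))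
    ... | yes ne with ∃-maximal rank ne
    ... | v , v∈X , max with kind v in kv
    ... | true  = Equivalence.from (con X ∣X∣≡k) (v , v∈X , kv , max)
    ... | false = contradiction 0<S (ℚ.<-asym (leader-isolated⇒subsetSum-neg X v∈X (last-strict max) kv))

  module _ (1≤k : 1 ≤ k) where

    edge⇔dominatingLast : ∀ {S x} → ∣ S ∣ ≡ k ∸ 1 → x ∉ S → E H (S ∪ ⁅ x ⁆) ⇔ HasDominatingLast (S ∪ ⁅ x ⁆)
    edge⇔dominatingLast {S} ∣S∣ x∉S =
      con (S ∪ ⁅ _ ⁆) (trans (∣p∪⁅x⁆∣≡1+∣p∣ S x∉S) (trans (cong suc ∣S∣) (ℕ.m+[n∸m]≡n 1≤k)))

    last-kept : ∀ {S x y w} → w ∈ S → kind w ≡ true → (∀ u → u ∈ S ∪ ⁅ x ⁆ → rank u ≤ rank w) →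
                rank y ≤ rank w → HasDominatingLast (S ∪ ⁅ y ⁆)
    last-kept {S} {w = w} w∈S kw max y≤w =
      w , x∈p∪q⁺ (inj₁ w∈S) , kw , ∪⁅⁆-all S (λ u → max u ∘ x∈p∪q⁺ ∘ inj₁) y≤w

    dominating-above : ∀ {x y} → rank x < rank y → kind y ≡ true → Below H x y
    dominating-above {x} {y} x<y ky S ∣S∣ x∉S y∉S e
      with Equivalence.to (edge⇔dominatingLast ∣S∣ x∉S) e
    ... | w , w∈ , kw , max with rank w ℕ.≤? rank y
    ... | yes w≤y = Equivalence.from (edge⇔dominatingLast ∣S∣ y∉S)
      (y , x∈p∪q⁺ (inj₂ (x∈⁅x⁆ y)) , ky ,
       ∪⁅⁆-all S (λ u u∈S → ℕ.≤-trans (max u (x∈p∪q⁺ (inj₁ u∈S))) w≤y) ℕ.≤-refl)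
    ... | no w≰y = Equivalence.from (edge⇔dominatingLast ∣S∣ y∉S)
      (last-kept (∪⁅⁆-∈-≢ S w∈ w≢x) kw max (ℕ.≰⇒≥ w≰y))
      where
      w≢x : w ≢ x
      w≢x refl = w≰y (ℕ.<⇒≤ x<y)

    isolated-below : ∀ {x y} → rank x < rank y → kind y ≡ false → Below H y x
    isolated-below {x} {y} x<y ky S ∣S∣ y∉S x∉S e
      with Equivalence.to (edge⇔dominatingLast ∣S∣ y∉S) e
    ... | w , w∈ , kw , max = Equivalence.from (edge⇔dominatingLast ∣S∣ x∉S)
      (last-kept (∪⁅⁆-∈-≢ S w∈ w≢y) kw max (ℕ.≤-trans (ℕ.<⇒≤ x<y) (max y (x∈p∪q⁺ (inj₂ (x∈⁅x⁆ y))))))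
      where
      w≢y : w ≢ y
      w≢y refl with trans (sym kw) ky
      ... | ()

    rank-ordered : ∀ {x y} → rank x < rank y → Below H x y ⊎ Below H y x
    rank-ordered {y = y} x<y with kind y in ky
    ... | true  = inj₁ (dominating-above x<y ky)
    ... | false = inj₂ (isolated-below x<y ky)

    isT3Threshold : T3Threshold H
    isT3Threshold x y with ℕ.<-cmp (rank x) (rank y)
    ... | tri< x<y _ _ = rank-ordered x<y
    ... | tri≈ _ x≡y _ = inj₁ (subst (Below H x) (rank-injective x≡y) λ _ _ _ _ e → e)
    ... | tri> _ _ y<x = swap (rank-ordered y<x)

constructable⇒threshold : ∀ {k} → 1 ≤ k → (H : Hypergraph k) → Constructable01 H →
                          T2Threshold H × T3Threshold H
constructable⇒threshold 1≤k H (pos , kind , con) = isT2Threshold , isT3Threshold 1≤k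
  where open Constructed H pos kind con

antiregular⇒constructable01 : ∀ {k} (H : Hypergraph k) → Antiregular H → Constructable01 H
antiregular⇒constructable01 H (pos , _ , con) = pos , _ , con

theorem4p3 : (k : ℕ) → 3 ≤ k →
    ((H : Hypergraph k) → Constructable01 H → T2Threshold H × T3Threshold H)
    × ((H : Hypergraph k) → Antiregular H → T2Threshold H × T3Threshold H)
theorem4p3 k 3≤k = threshold , λ H → threshold H ∘ antiregular⇒constructable01 H
  where
  threshold : (H : Hypergraph k) → Constructable01 H → T2Threshold H × T3Threshold H
  threshold = constructable⇒threshold (ℕ.≤-trans (s≤s z≤n) 3≤k)
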